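{- Let $A$ be a connected FDDS of period $p$ (the length of its cycle), let $\mathbf{t}$ be an unroll tree of $\mathcal{U}(A)$, and let $n\ge p+\mathrm{depth}(\mathcal{U}(A))$. Let $(v_n,\ldots,v_0)$ be a directed path in $[\mathbf{t}]_n$ such that $\mathrm{depth}(v_n)=n$ and $v_0$ is the root. Then the nodes $v_p,\ldots,v_0$ lie on the infinite branch of $\mathbf{t}$.
   Context: A finite discrete-time dynamical system (FDDS) is a pair $(S,f)$ with $S$ a finite set and $f:S\to S$, identified with its transition digraph; it is connected if this digraph is weakly connected (one cycle). A state is periodic if it lies on a cycle. The depth of an FDDS is the maximum over states $s$ of the least $t\ge0$ with $f^t(s)$ periodic. For a periodic state $u$, the unroll tree in $u$ is the infinite rooted tree with vertex set $\{(s,k)\mid k\in\mathbb{N},\ f^k(s)=u\}$, root $(u,0)$ and arcs $(v,k)\to(f(v),k-1)$; it has exactly one infinite branch (the vertices $(s,k)$ with $s$ periodic). The unroll $\mathcal{U}(A)$ is the multiset of unroll trees of $A$, and $\mathrm{depth}(\mathcal{U}(A))=\mathrm{depth}(A)$. The depth of a node of a rooted tree is its distance to the root, and $[\mathbf{t}]_n$ is the induced subtree on vertices of depth at most $n$. -}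

module Defs where

open import Data.Nat using (ℕ; zero; suc; _≤_; _<_; _+_; _∸_)
open import Data.Fin using (Fin; toℕ; inject₁)
open import Data.Product using (Σ; ∃; _×_; _,_; proj₁; proj₂)
open import Relation.Binary.PropositionalEquality using (_≡_; _≢_)
open import Relation.Nullary using (¬_)

FDDS : ℕ → Set
FDDS m = Fin m → Fin m

iter : ∀ {m} → FDDS m → ℕ → Fin m → Fin m
iter f zero    x = x
iter f (suc k) x = f (iter f k x)

-- Undirected reachability in the transition digraph (arcs x → f x).
data WConn {m} (f : FDDS m) : Fin m → Fin m → Set where
  wrefl : ∀ {x} → WConn f x x
  wfwd  : ∀ {x y} → WConn f x y → WConn f x (f y)
  wbwd  : ∀ {x y} → WConn f x (f y) → WConn f x y

Connected : ∀ {m} → FDDS m → Set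
Connected f = ∀ x y → WConn f x y

Periodic : ∀ {m} → FDDS m → Fin m → Set
Periodic f s = Σ ℕ λ t → (1 ≤ t) × (iter f t s ≡ s)

-- p is the length of a cycle of f (the period, for connected f)
IsPeriod : ∀ {m} → FDDS m → ℕ → Set
IsPeriod f p = Σ _ λ u → (1 ≤ p) × (iter f p u ≡ u)
                       × (∀ t → 1 ≤ t → t < p → iter f t u ≢ u)

-- d is the depth: max over s of the least t with f^t(s) periodic
IsDepth : ∀ {m} → FDDS m → ℕ → Set
IsDepth f d = (∀ s → Σ ℕ λ t → (t ≤ d) × Periodic f (iter f t s))
            × (Σ _ λ s → ∀ t → t < d → ¬ Periodic f (iter f t s))

-- vertices of the unroll tree in u: pairs (s,k) with f^k(s) = u
record UVert {m} (f : FDDS m) (u : Fin m) : Set where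
  constructor uv
  field
    state : Fin m
    level : ℕ
    reach : iter f level state ≡ u
open UVert public

IsRoot : ∀ {m} {f : FDDS m} {u} → UVert f u → Set
IsRoot {u = u} v = (state v ≡ u) × (level v ≡ 0)

Arc : ∀ {m} {f : FDDS m} {u} → UVert f u → UVert f u → Set
Arc {f = f} a b = (state b ≡ f (state a)) × (level a ≡ suc (level b))

-- depth of a node of the unroll tree = distance to the root = its level k
nodeDepth : ∀ {m} {f : FDDS m} {u} → UVert f u → ℕ
nodeDepth = level

-- the infinite branch: nodes (s,k) with s periodic
OnInfiniteBranch : ∀ {m} {f : FDDS m} {u} → UVert f u → Set
OnInfiniteBranch {f = f} v = Periodic f (state v)

-- Along the path, the state of v i is f^(n - i)(state of v n).  For i ≤ p we
-- have n - i ≥ d, and iterating f at least depth-many times lands on a cycle.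
module Submission where

open import Defs
open import Data.Nat using (zero; suc; _≤_; _+_; _∸_)
open import Data.Nat.Properties
  using (+-comm; ≤-trans; ≤-reflexive; +-monoʳ-≤; m∸n+n≡m; m+n≤o⇒m≤o∸n)
open import Data.Fin using (Fin; toℕ; inject₁; fromℕ)
open import Data.Product using (_,_; proj₁)
open import Function using (_∘_)
open import Relation.Binary.PropositionalEquality
  using (_≡_; refl; sym; trans; cong; subst; module ≡-Reasoning)

module _ {m} (f : FDDS m) where

  iter-comm : ∀ k x → iter f k (f x) ≡ f (iter f k x)
  iter-comm zero    x = refl
  iter-comm (suc k) x = cong f (iter-comm k x)

  iter-+ : ∀ a b x → iter f (a + b) x ≡ iter f a (iter f b x)
  iter-+ zero    b x = refl
  iter-+ (suc a) b x = cong f (iter-+ a b x)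

  Periodic-f : ∀ {x} → Periodic f x → Periodic f (f x)
  Periodic-f {x} (t , 1≤t , cycle) = t , 1≤t , trans (iter-comm t x) (cong f cycle)

  Periodic-iter : ∀ k {x} → Periodic f x → Periodic f (iter f k x)
  Periodic-iter zero    P = P
  Periodic-iter (suc k) P = Periodic-f (Periodic-iter k P)

  Periodic-iter-≥depth : ∀ {d} → IsDepth f d → ∀ {k} → d ≤ k → ∀ s → Periodic f (iter f k s)
  Periodic-iter-≥depth (reaches , _) {k} d≤k s with reaches s
  ... | t , t≤d , P = subst (Periodic f) f^k≡f^[k-t]∘f^t (Periodic-iter (k ∸ t) P)
    where
      open ≡-Reasoning
      f^k≡f^[k-t]∘f^t : iter f (k ∸ t) (iter f t s) ≡ iter f k s
      f^k≡f^[k-t]∘f^t = begin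
        iter f (k ∸ t) (iter f t s) ≡⟨ sym (iter-+ (k ∸ t) t s) ⟩
        iter f (k ∸ t + t) s        ≡⟨ cong (λ j → iter f j s) (m∸n+n≡m (≤-trans t≤d d≤k)) ⟩
        iter f k s                  ∎

  -- Dropping the root v 0 leaves a path of length n - 1, whose arcs are those of
  -- v since inject₁ (suc i) and fromℕ (suc n) reduce to suc (inject₁ i) and suc (fromℕ n).
  state≡iter-top : ∀ {u} n (v : Fin (suc n) → UVert f u)
    → (∀ (i : Fin n) → Arc (v (Fin.suc i)) (v (inject₁ i)))
    → ∀ i → state (v i) ≡ iter f (n ∸ toℕ i) (state (v (fromℕ n)))
  state≡iter-top zero    v arc Fin.zero    = refl
  state≡iter-top (suc n) v arc Fin.zero    =
    trans (proj₁ (arc Fin.zero)) (cong f (state≡iter-top n (v ∘ Fin.suc) (arc ∘ Fin.suc) Fin.zero))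
  state≡iter-top (suc n) v arc (Fin.suc i) = state≡iter-top n (v ∘ Fin.suc) (arc ∘ Fin.suc) i

lemma3 : ∀ {m} (f : FDDS m) → Connected f
    → ∀ p → IsPeriod f p
    → ∀ (u : Fin m) → Periodic f u
    → ∀ d → IsDepth f d
    → ∀ n → p + d ≤ n
    → (v : Fin (suc n) → UVert f u)
    → (∀ i → nodeDepth (v i) ≤ n)
    → (∀ (i : Fin n) → Arc (v (Fin.suc i)) (v (inject₁ i)))
    → nodeDepth (v (fromℕ n)) ≡ n
    → IsRoot (v Fin.zero)
    → ∀ (i : Fin (suc n)) → toℕ i ≤ p → OnInfiniteBranch (v i)
lemma3 f _ p _ u _ d depth n p+d≤n v _ arc _ _ i i≤p =
  subst (Periodic f) (sym (state≡iter-top f n v arc i))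
        (Periodic-iter-≥depth f depth d≤n∸i (state (v (fromℕ n))))
  where
    d+i≤n : d + toℕ i ≤ n
    d+i≤n = ≤-trans (+-monoʳ-≤ d i≤p) (≤-trans (≤-reflexive (+-comm d p)) p+d≤n)

    d≤n∸i : d ≤ n ∸ toℕ i
    d≤n∸i = m+n≤o⇒m≤o∸n d d+i≤n
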